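{- Let $G$ be an $r$-regular simple graph on $n$ vertices, where $n/2$ is an even integer and $r \geq n/2$. If $G$ contains the complete graph $K_{n/2}$ as a subgraph, then the complement $G^c$ is bipartite.
   Context: All graphs are finite and simple; $G^c$ denotes the complement of $G$ on the same vertex set. -}

module Defs where

open import Data.Nat using (ℕ)
open import Data.Fin using (Fin)
open import Data.Bool using (Bool)
open import Data.List using (length; filter)
open import Data.List using () renaming (List to L)
open import Data.Fin using () 
open import Data.Vec.Functional using ()
open import Data.Product using (Σ; _×_; ∃; _,_)
open import Relation.Nullary using (¬_; Dec)
open import Relation.Binary.PropositionalEquality using (_≡_; _≢_)
open import Function.Definitions using (Injective)
import Data.List as List
import Data.Fin as F

record SimpleGraph (n : ℕ) : Set₁ where
  field
    Adj    : Fin n → Fin n → Set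
    adj?   : ∀ u v → Dec (Adj u v)
    sym    : ∀ {u v} → Adj u v → Adj v u
    irrefl : ∀ {u} → ¬ Adj u u
open SimpleGraph public

degree : ∀ {n} → SimpleGraph n → Fin n → ℕ
degree {n} G v = length (filter (adj? G v) (List.allFin n))

IsRegular : ∀ {n} → SimpleGraph n → ℕ → Set
IsRegular G r = ∀ v → degree G v ≡ r

complement : ∀ {n} → SimpleGraph n → SimpleGraph n
complement {n} G = record
  { Adj    = λ u v → (u ≢ v) × ¬ Adj G u v
  ; adj?   = dec
  ; sym    = λ { (u≢v , ¬a) → (λ e → u≢v (Eq.sym e)) , (λ a → ¬a (SimpleGraph.sym G a)) }
  ; irrefl = λ { (u≢u , _) → u≢u Eq.refl }
  }
  where
  import Relation.Binary.PropositionalEquality as Eq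
  open import Relation.Nullary using (yes; no; _×-dec_; ¬?)
  dec : ∀ u v → Dec ((u ≢ v) × ¬ Adj G u v)
  dec u v = ¬? (u F.≟ v) ×-dec ¬? (adj? G u v)

IsBipartite : ∀ {n} → SimpleGraph n → Set
IsBipartite {n} G = Σ (Fin n → Bool) λ c → ∀ u v → Adj G u v → c u ≢ c v

ContainsComplete : ∀ {n} → SimpleGraph n → ℕ → Set
ContainsComplete {n} G m =
  Σ (Fin m → Fin n) λ f → Injective _≡_ _≡_ f × (∀ i j → i ≢ j → Adj G (f i) (f j))

-- Let A be the vertex set of the clique and B its complement, so |A| = |B| = h.
-- Summing the degrees over A and over B gives h r = e(A,A) + e(A,B) = e(B,A) + e(B,B),
-- where e counts ordered adjacent pairs; hence e(B,B) = e(A,A) = h(h - 1), which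
-- forces B to be a clique as well. Every edge of the complement then joins A to B.
module Submission where

open import Defs hiding (sym)
open import Data.Nat using (ℕ; _*_; _≥_)
open import Data.Nat.Divisibility using (_∣_)
open import Relation.Binary.PropositionalEquality using (_≡_)

open import Data.Bool using (if_then_else_)
open import Data.Empty using (⊥-elim)
open import Data.Fin using (Fin; zero; suc)
open import Data.Fin.Properties using (_≟_; any?)
open import Data.List using (filter; length; tabulate)
open import Data.Nat using (zero; suc; _+_; _≤_; _<_; z≤n; s≤s)
open import Data.Nat.Properties
  using (+-identityʳ; *-identityˡ; *-identityʳ; *-zeroʳ; *-comm; *-distribˡ-+; *-distribʳ-+;
         +-comm; +-cancelˡ-≡; +-cancelʳ-≡; +-mono-≤; +-mono-<-≤; +-mono-≤-<; +-monoˡ-<; *-monoʳ-≤; ≤-refl; <-irrefl;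
         *-commutativeSemigroup; +-*-semiring; module ≤-Reasoning)
open import Algebra.Properties.CommutativeSemigroup *-commutativeSemigroup using (x∙yz≈y∙xz)
open import Algebra.Properties.Semiring.Sum +-*-semiring
  using (sum; sum-syntax; sum-cong-≗; sum-replicate-zero; ∑-distrib-+; ∑-comm; *-distribˡ-sum; *-distribʳ-sum)
open import Data.Product using (∃; _,_)
open import Function.Definitions using (Injective)
open import Level using (Level)
open import Relation.Binary.PropositionalEquality
  using (refl; sym; trans; cong; cong₂; subst; subst₂; _≢_; module ≡-Reasoning)
open import Relation.Nullary using (¬_; Dec; yes; no; does; ¬?)
open import Relation.Unary using (Pred; Decidable; ∁)
open import Relation.Unary.Properties using (∁?)

private variable
  ℓ : Level
  A B : Set ℓ
  m n h : ℕ

𝟙 : Dec A → ℕ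
𝟙 d = if does d then 1 else 0

𝟙-yes : (d : Dec A) → A → 𝟙 d ≡ 1
𝟙-yes (yes _) _ = refl
𝟙-yes (no ¬a) a = ⊥-elim (¬a a)

𝟙-no : (d : Dec A) → ¬ A → 𝟙 d ≡ 0
𝟙-no (yes a) ¬a = ⊥-elim (¬a a)
𝟙-no (no _)  _  = refl

𝟙≤1 : (d : Dec A) → 𝟙 d ≤ 1
𝟙≤1 (yes _) = ≤-refl
𝟙≤1 (no _)  = z≤n

𝟙-⇔ : (d : Dec A) (e : Dec B) → (A → B) → (B → A) → 𝟙 d ≡ 𝟙 e
𝟙-⇔ (yes a) e to _    = sym (𝟙-yes e (to a))
𝟙-⇔ (no ¬a) e _  from = sym (𝟙-no e (λ b → ¬a (from b)))

𝟙+𝟙¬ : (d : Dec A) → 𝟙 d + 𝟙 (¬? d) ≡ 1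
𝟙+𝟙¬ (yes _) = refl
𝟙+𝟙¬ (no _)  = refl

𝟙*-cong : ∀ {x y} (d : Dec A) → (A → x ≡ y) → 𝟙 d * x ≡ 𝟙 d * y
𝟙*-cong (yes a) x≡y = cong (_+ 0) (x≡y a)
𝟙*-cong (no _)  _   = refl

𝟙*-mono : ∀ {x y} (d : Dec A) → (A → x ≤ y) → 𝟙 d * x ≤ 𝟙 d * y
𝟙*-mono (yes a) x≤y = +-mono-≤ (x≤y a) ≤-refl
𝟙*-mono (no _)  _   = z≤n

∑-const : ∀ m c → ∑[ i < m ] c ≡ m * c
∑-const zero    c = refl
∑-const (suc m) c = cong (c +_) (∑-const m c)

∑-mono-≤ : {f g : Fin m → ℕ} → (∀ i → f i ≤ g i) → sum f ≤ sum g
∑-mono-≤ {zero}  _   = z≤n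
∑-mono-≤ {suc m} f≤g = +-mono-≤ (f≤g zero) (∑-mono-≤ (λ i → f≤g (suc i)))

∑-mono-< : {f g : Fin m → ℕ} → (∀ i → f i ≤ g i) → ∀ k → f k < g k → sum f < sum g
∑-mono-< f≤g zero    fk<gk = +-mono-<-≤ fk<gk (∑-mono-≤ (λ i → f≤g (suc i)))
∑-mono-< f≤g (suc k) fk<gk = +-mono-≤-< (f≤g zero) (∑-mono-< (λ i → f≤g (suc i)) k fk<gk)

∑-δ : (u : Fin m) (g : Fin m → ℕ) → ∑[ v < m ] (𝟙 (u ≟ v) * g v) ≡ g u
∑-δ {suc m} zero    g =
  trans (cong₂ _+_ (+-identityʳ (g zero)) (sum-replicate-zero m)) (+-identityʳ (g zero))
∑-δ {suc m} (suc u) g = ∑-δ u (λ v → g (suc v))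

∑-𝟙≟ : (u : Fin m) → ∑[ v < m ] 𝟙 (u ≟ v) ≡ 1
∑-𝟙≟ u = trans (sum-cong-≗ (λ v → sym (*-identityʳ (𝟙 (u ≟ v))))) (∑-δ u (λ _ → 1))

length-filter-tabulate : {P : Pred A ℓ} (P? : Decidable P) (g : Fin m → A) →
                         length (filter P? (tabulate g)) ≡ ∑[ i < m ] 𝟙 (P? (g i))
length-filter-tabulate {m = zero}  P? g = refl
length-filter-tabulate {m = suc m} P? g with P? (g zero)
... | yes _ = cong suc (length-filter-tabulate P? (λ i → g (suc i)))
... | no  _ = length-filter-tabulate P? (λ i → g (suc i))

χ : {P : Pred (Fin m) ℓ} → Decidable P → Fin m → ℕ
χ P? v = 𝟙 (P? v)

size : {P : Pred (Fin m) ℓ} → Decidable P → ℕ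
size P? = sum (χ P?)

size+size-∁ : {P : Pred (Fin m) ℓ} (P? : Decidable P) → size P? + size (∁? P?) ≡ m
size+size-∁ {m = m} P? = begin
  size P? + size (∁? P?)            ≡⟨ ∑-distrib-+ (χ P?) (χ (∁? P?)) ⟨
  ∑[ v < m ] (χ P? v + χ (∁? P?) v) ≡⟨ sum-cong-≗ (λ v → 𝟙+𝟙¬ (P? v)) ⟩
  ∑[ v < m ] 1                      ≡⟨ ∑-const m 1 ⟩
  m * 1                             ≡⟨ *-identityʳ m ⟩
  m                                 ∎
  where open ≡-Reasoning

size-∁-half : {P : Pred (Fin m) ℓ} (P? : Decidable P) → m ≡ 2 * h → size P? ≡ h → size (∁? P?) ≡ h
size-∁-half {m = m} {h = h} P? m≡2h |P|≡h = +-cancelˡ-≡ h (size (∁? P?)) h (begin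
  h + size (∁? P?)        ≡⟨ cong (_+ size (∁? P?)) |P|≡h ⟨
  size P? + size (∁? P?)  ≡⟨ size+size-∁ P? ⟩
  m                       ≡⟨ m≡2h ⟩
  h + (h + 0)             ≡⟨ cong (h +_) (+-identityʳ h) ⟩
  h + h                   ∎)
  where open ≡-Reasoning

image : (Fin m → Fin n) → Pred (Fin n) Level.zero
image f v = ∃ λ i → f i ≡ v

image? : (f : Fin m → Fin n) → Decidable (image f)
image? f v = any? (λ i → f i ≟ v)

module _ {f : Fin m → Fin n} (f-inj : Injective _≡_ _≡_ f) where

  χ-image : ∀ v → χ (image? f) v ≡ ∑[ i < m ] 𝟙 (f i ≟ v)
  χ-image v with image? f v
  ... | yes (i , fi≡v) = sym (trans (sum-cong-≗ fi≟v⇔i≟j) (∑-𝟙≟ i))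
    where
    fi≟v⇔i≟j : ∀ j → 𝟙 (f j ≟ v) ≡ 𝟙 (i ≟ j)
    fi≟v⇔i≟j j = 𝟙-⇔ (f j ≟ v) (i ≟ j) (λ fj≡v → f-inj (trans fi≡v (sym fj≡v)))
                                         (λ i≡j → trans (cong f (sym i≡j)) fi≡v)
  ... | no  ∄i         = sym (trans (sum-cong-≗ (λ j → 𝟙-no (f j ≟ v) (λ fj≡v → ∄i (j , fj≡v))))
                                    (sum-replicate-zero m))

  size-image : size (image? f) ≡ m
  size-image = begin
    ∑[ v < n ] χ (image? f) v            ≡⟨ sum-cong-≗ χ-image ⟩
    ∑[ v < n ] ∑[ i < m ] 𝟙 (f i ≟ v)    ≡⟨ ∑-comm (λ v i → 𝟙 (f i ≟ v)) ⟩
    ∑[ i < m ] ∑[ v < n ] 𝟙 (f i ≟ v)    ≡⟨ sum-cong-≗ (λ i → ∑-𝟙≟ (f i)) ⟩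
    ∑[ i < m ] 1                         ≡⟨ ∑-const m 1 ⟩
    m * 1                                ≡⟨ *-identityʳ m ⟩
    m                                    ∎
    where open ≡-Reasoning

module _ (G : SimpleGraph n) where

  edge : Fin n → Fin n → ℕ
  edge u v = 𝟙 (adj? G u v)

  edge-sym : ∀ u v → edge u v ≡ edge v u
  edge-sym u v = 𝟙-⇔ (adj? G u v) (adj? G v u) (SimpleGraph.sym G) (SimpleGraph.sym G)

  edge+δ≤1 : ∀ u v → edge u v + 𝟙 (u ≟ v) ≤ 1
  edge+δ≤1 u v with u ≟ v
  ... | yes refl = subst (λ e → e + 1 ≤ 1) (sym (𝟙-no (adj? G u u) (irrefl G))) ≤-refl
  ... | no  _    = subst (_≤ 1) (sym (+-identityʳ (edge u v))) (𝟙≤1 (adj? G u v))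

  edge+δ≡1 : ∀ u v → (u ≢ v → Adj G u v) → edge u v + 𝟙 (u ≟ v) ≡ 1
  edge+δ≡1 u v adj with u ≟ v
  ... | yes refl = cong (_+ 1) (𝟙-no (adj? G u u) (irrefl G))
  ... | no  u≢v  = cong (_+ 0) (𝟙-yes (adj? G u v) (adj u≢v))

  edge+δ≡0 : ∀ {u v} → u ≢ v → ¬ Adj G u v → edge u v + 𝟙 (u ≟ v) ≡ 0
  edge+δ≡0 {u} {v} u≢v ¬adj = cong₂ _+_ (𝟙-no (adj? G u v) ¬adj) (𝟙-no (u ≟ v) u≢v)

  degree≡∑edge : ∀ u → degree G u ≡ ∑[ v < n ] edge u v
  degree≡∑edge u = length-filter-tabulate (adj? G u) (λ v → v)

  degreeIn : (Fin n → ℕ) → Fin n → ℕ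
  degreeIn q u = ∑[ v < n ] (q v * edge u v)

  edges : (Fin n → ℕ) → (Fin n → ℕ) → ℕ
  edges p q = ∑[ u < n ] (p u * degreeIn q u)

  edges-comm : ∀ p q → edges p q ≡ edges q p
  edges-comm p q = begin
    ∑[ u < n ] (p u * ∑[ v < n ] (q v * edge u v))  ≡⟨ sum-cong-≗ (λ u → *-distribˡ-sum (p u) (λ v → q v * edge u v)) ⟩
    ∑[ u < n ] ∑[ v < n ] (p u * (q v * edge u v))  ≡⟨ ∑-comm (λ u v → p u * (q v * edge u v)) ⟩
    ∑[ v < n ] ∑[ u < n ] (p u * (q v * edge u v))  ≡⟨ sum-cong-≗ (λ v → sum-cong-≗ (λ u → swap u v)) ⟩
    ∑[ v < n ] ∑[ u < n ] (q v * (p u * edge v u))  ≡⟨ sum-cong-≗ (λ v → *-distribˡ-sum (q v) (λ u → p u * edge v u)) ⟨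
    ∑[ v < n ] (q v * ∑[ u < n ] (p u * edge v u))  ∎
    where
    open ≡-Reasoning
    swap : ∀ u v → p u * (q v * edge u v) ≡ q v * (p u * edge v u)
    swap u v = trans (x∙yz≈y∙xz (p u) (q v) (edge u v)) (cong (λ e → q v * (p u * e)) (edge-sym u v))

  IsClique : Pred (Fin n) ℓ → Set ℓ
  IsClique P = ∀ {u v} → P u → P v → u ≢ v → Adj G u v

  cliques⇒complement-bipartite : {P : Pred (Fin n) ℓ} (P? : Decidable P) →
    IsClique P → IsClique (∁ P) → IsBipartite (complement G)
  cliques⇒complement-bipartite P? P-clique ∁P-clique = (λ v → does (P? v)) , separated
    where
    separated : ∀ u v → Adj (complement G) u v → does (P? u) ≢ does (P? v)
    separated u v (u≢v , ¬adj) with P? u | P? v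
    ... | yes Pu  | yes Pv  = λ _ → ¬adj (P-clique Pu Pv u≢v)
    ... | yes _   | no  _   = λ ()
    ... | no  _   | yes _   = λ ()
    ... | no  ¬Pu | no  ¬Pv = λ _ → ¬adj (∁P-clique ¬Pu ¬Pv u≢v)

  module _ {P : Pred (Fin n) ℓ} (P? : Decidable P) where

    degree-split : ∀ u → degree G u ≡ degreeIn (χ P?) u + degreeIn (χ (∁? P?)) u
    degree-split u = begin
      degree G u                                           ≡⟨ degree≡∑edge u ⟩
      ∑[ v < n ] edge u v                                  ≡⟨ sum-cong-≗ split ⟩
      ∑[ v < n ] (χ P? v * edge u v + χ (∁? P?) v * edge u v)
        ≡⟨ ∑-distrib-+ (λ v → χ P? v * edge u v) (λ v → χ (∁? P?) v * edge u v) ⟩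
      degreeIn (χ P?) u + degreeIn (χ (∁? P?)) u           ∎
      where
      open ≡-Reasoning
      split : ∀ v → edge u v ≡ χ P? v * edge u v + χ (∁? P?) v * edge u v
      split v = begin
        edge u v                                      ≡⟨ *-identityˡ (edge u v) ⟨
        1 * edge u v                                  ≡⟨ cong (_* edge u v) (𝟙+𝟙¬ (P? v)) ⟨
        (χ P? v + χ (∁? P?) v) * edge u v             ≡⟨ *-distribʳ-+ (edge u v) (χ P? v) (χ (∁? P?) v) ⟩
        χ P? v * edge u v + χ (∁? P?) v * edge u v    ∎

    regular⇒edges-split : ∀ {r} → IsRegular G r →
      ∀ p → sum p * r ≡ edges p (χ P?) + edges p (χ (∁? P?))
    regular⇒edges-split {r} regular p = begin
      sum p * r                                                 ≡⟨ *-distribʳ-sum r p ⟩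
      ∑[ u < n ] (p u * r)                                      ≡⟨ sum-cong-≗ split ⟩
      ∑[ u < n ] (p u * degreeIn (χ P?) u + p u * degreeIn (χ (∁? P?)) u)
        ≡⟨ ∑-distrib-+ (λ u → p u * degreeIn (χ P?) u) (λ u → p u * degreeIn (χ (∁? P?)) u) ⟩
      edges p (χ P?) + edges p (χ (∁? P?))                      ∎
      where
      open ≡-Reasoning
      split : ∀ u → p u * r ≡ p u * degreeIn (χ P?) u + p u * degreeIn (χ (∁? P?)) u
      split u = trans (cong (p u *_) (trans (sym (regular u)) (degree-split u)))
                      (*-distribˡ-+ (p u) (degreeIn (χ P?) u) (degreeIn (χ (∁? P?)) u))

    -- Both sides equal |P| r − e(P, ∁P), using e(P, ∁P) = e(∁P, P).
    regular⇒edges-∁-balanced : ∀ {r} → IsRegular G r → size P? ≡ size (∁? P?) →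
      edges (χ (∁? P?)) (χ (∁? P?)) ≡ edges (χ P?) (χ P?)
    regular⇒edges-∁-balanced {r} regular |P|≡|∁P| =
      +-cancelʳ-≡ (edges χP χ∁P) (edges χ∁P χ∁P) (edges χP χP) (begin
        edges χ∁P χ∁P + edges χP χ∁P  ≡⟨ +-comm (edges χ∁P χ∁P) (edges χP χ∁P) ⟩
        edges χP χ∁P + edges χ∁P χ∁P  ≡⟨ cong (_+ edges χ∁P χ∁P) (edges-comm χP χ∁P) ⟩
        edges χ∁P χP + edges χ∁P χ∁P  ≡⟨ regular⇒edges-split regular χ∁P ⟨
        size (∁? P?) * r              ≡⟨ cong (_* r) |P|≡|∁P| ⟨
        size P? * r                   ≡⟨ regular⇒edges-split regular χP ⟩
        edges χP χP + edges χP χ∁P    ∎)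
      where
      open ≡-Reasoning
      χP χ∁P : Fin n → ℕ
      χP  = χ P?
      χ∁P = χ (∁? P?)

    closedDegreeIn : Fin n → ℕ
    closedDegreeIn u = ∑[ v < n ] (χ P? v * (edge u v + 𝟙 (u ≟ v)))

    closedDegreeIn≡ : ∀ u → closedDegreeIn u ≡ degreeIn (χ P?) u + χ P? u
    closedDegreeIn≡ u = begin
      ∑[ v < n ] (χ P? v * (edge u v + 𝟙 (u ≟ v)))
        ≡⟨ sum-cong-≗ (λ v → *-distribˡ-+ (χ P? v) (edge u v) (𝟙 (u ≟ v))) ⟩
      ∑[ v < n ] (χ P? v * edge u v + χ P? v * 𝟙 (u ≟ v))
        ≡⟨ ∑-distrib-+ (λ v → χ P? v * edge u v) (λ v → χ P? v * 𝟙 (u ≟ v)) ⟩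
      degreeIn (χ P?) u + ∑[ v < n ] (χ P? v * 𝟙 (u ≟ v))
        ≡⟨ cong (degreeIn (χ P?) u +_) (trans (sum-cong-≗ (λ v → *-comm (χ P? v) (𝟙 (u ≟ v)))) (∑-δ u (χ P?))) ⟩
      degreeIn (χ P?) u + χ P? u
        ∎
      where open ≡-Reasoning

    closedDegreeIn-term≤χ : ∀ u v → χ P? v * (edge u v + 𝟙 (u ≟ v)) ≤ χ P? v
    closedDegreeIn-term≤χ u v =
      subst (χ P? v * (edge u v + 𝟙 (u ≟ v)) ≤_) (*-identityʳ (χ P? v)) (*-monoʳ-≤ (χ P? v) (edge+δ≤1 u v))

    closedDegreeIn≤size : ∀ u → closedDegreeIn u ≤ size P?
    closedDegreeIn≤size u = ∑-mono-≤ (closedDegreeIn-term≤χ u)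

    clique⇒closedDegreeIn≡size : IsClique P → ∀ {u} → P u → closedDegreeIn u ≡ size P?
    clique⇒closedDegreeIn≡size P-clique {u} Pu = sum-cong-≗ λ v →
      trans (𝟙*-cong (P? v) (λ Pv → edge+δ≡1 u v (P-clique Pu Pv))) (*-identityʳ (χ P? v))

    nonAdjacent⇒closedDegreeIn<size : ∀ {u v} → P v → u ≢ v → ¬ Adj G u v → closedDegreeIn u < size P?
    nonAdjacent⇒closedDegreeIn<size {u} {v} Pv u≢v ¬adj = ∑-mono-< (closedDegreeIn-term≤χ u) v v-missed
      where
      v-missed : χ P? v * (edge u v + 𝟙 (u ≟ v)) < χ P? v
      v-missed = subst₂ _<_ (sym (trans (cong (χ P? v *_) (edge+δ≡0 u≢v ¬adj)) (*-zeroʳ (χ P? v))))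
                            (sym (𝟙-yes (P? v) Pv)) (s≤s z≤n)

    edges+size≡∑closedDegreeIn : edges (χ P?) (χ P?) + size P? ≡ ∑[ u < n ] (χ P? u * closedDegreeIn u)
    edges+size≡∑closedDegreeIn = trans (sym (∑-distrib-+ (λ u → χ P? u * degreeIn (χ P?) u) (χ P?)))
                                       (sum-cong-≗ pointwise)
      where
      open ≡-Reasoning
      pointwise : ∀ u → χ P? u * degreeIn (χ P?) u + χ P? u ≡ χ P? u * closedDegreeIn u
      pointwise u = begin
        χ P? u * degreeIn (χ P?) u + χ P? u      ≡⟨ cong (χ P? u * degreeIn (χ P?) u +_) (*-identityʳ (χ P? u)) ⟨
        χ P? u * degreeIn (χ P?) u + χ P? u * 1  ≡⟨ *-distribˡ-+ (χ P? u) (degreeIn (χ P?) u) 1 ⟨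
        χ P? u * (degreeIn (χ P?) u + 1)         ≡⟨ 𝟙*-cong (P? u) (λ Pu → sym (trans (closedDegreeIn≡ u)
                                                      (cong (degreeIn (χ P?) u +_) (𝟙-yes (P? u) Pu)))) ⟩
        χ P? u * closedDegreeIn u                ∎

    ∑size≡size*size : ∑[ u < n ] (χ P? u * size P?) ≡ size P? * size P?
    ∑size≡size*size = sym (*-distribʳ-sum (size P?) (χ P?))

    -- e(P, P) = |P|(|P| − 1), moved to the form below to avoid truncated subtraction.
    clique⇒edges+size≡size*size : IsClique P → edges (χ P?) (χ P?) + size P? ≡ size P? * size P?
    clique⇒edges+size≡size*size P-clique = begin
      edges (χ P?) (χ P?) + size P?          ≡⟨ edges+size≡∑closedDegreeIn ⟩
      ∑[ u < n ] (χ P? u * closedDegreeIn u) ≡⟨ sum-cong-≗ (λ u → 𝟙*-cong (P? u) (clique⇒closedDegreeIn≡size P-clique)) ⟩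
      ∑[ u < n ] (χ P? u * size P?)          ≡⟨ ∑size≡size*size ⟩
      size P? * size P?                      ∎
      where open ≡-Reasoning

    edges+size≡size*size⇒clique : edges (χ P?) (χ P?) + size P? ≡ size P? * size P? → IsClique P
    edges+size≡size*size⇒clique full {u} {v} Pu Pv u≢v with adj? G u v
    ... | yes adj = adj
    ... | no ¬adj = ⊥-elim (<-irrefl full (begin-strict
      edges (χ P?) (χ P?) + size P?          ≡⟨ edges+size≡∑closedDegreeIn ⟩
      ∑[ w < n ] (χ P? w * closedDegreeIn w) <⟨ ∑-mono-< (λ w → 𝟙*-mono (P? w) (λ _ → closedDegreeIn≤size w)) u u-deficient ⟩
      ∑[ w < n ] (χ P? w * size P?)          ≡⟨ ∑size≡size*size ⟩
      size P? * size P?                      ∎))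
      where
      open ≤-Reasoning
      u-deficient : χ P? u * closedDegreeIn u < χ P? u * size P?
      u-deficient = subst (λ c → c * closedDegreeIn u < c * size P?) (sym (𝟙-yes (P? u) Pu))
                     (+-monoˡ-< 0 (nonAdjacent⇒closedDegreeIn<size Pv u≢v ¬adj))

  regular⇒∁-clique : ∀ {r} {P : Pred (Fin n) ℓ} (P? : Decidable P) → IsRegular G r →
    size P? ≡ size (∁? P?) → IsClique P → IsClique (∁ P)
  regular⇒∁-clique P? regular |P|≡|∁P| P-clique = edges+size≡size*size⇒clique (∁? P?) (begin
    edges (χ (∁? P?)) (χ (∁? P?)) + size (∁? P?)
      ≡⟨ cong₂ _+_ (regular⇒edges-∁-balanced P? regular |P|≡|∁P|) (sym |P|≡|∁P|) ⟩
    edges (χ P?) (χ P?) + size P?                   ≡⟨ clique⇒edges+size≡size*size P? P-clique ⟩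
    size P? * size P?                               ≡⟨ cong₂ _*_ |P|≡|∁P| |P|≡|∁P| ⟩
    size (∁? P?) * size (∁? P?)                     ∎)
    where open ≡-Reasoning

  image-clique : {f : Fin m → Fin n} → (∀ i j → i ≢ j → Adj G (f i) (f j)) → IsClique (image f)
  image-clique {f = f} f-clique (i , refl) (j , refl) fi≢fj = f-clique i j (λ i≡j → fi≢fj (cong f i≡j))

mainTheorem7 : (n h r : ℕ) → n ≡ 2 * h → 2 ∣ h → r ≥ h →
    (G : SimpleGraph n) → IsRegular G r → ContainsComplete G h →
    IsBipartite (complement G)
mainTheorem7 n h r n≡2h _ _ G regular (f , f-inj , f-clique) =
  cliques⇒complement-bipartite G A? A-clique (regular⇒∁-clique G A? regular |A|≡|∁A| A-clique)
  where
  A? : Decidable (image f)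
  A? = image? f
  A-clique : IsClique G (image f)
  A-clique = image-clique G f-clique
  |A|≡h : size A? ≡ h
  |A|≡h = size-image f-inj
  |A|≡|∁A| : size A? ≡ size (∁? A?)
  |A|≡|∁A| = trans |A|≡h (sym (size-∁-half A? n≡2h |A|≡h))
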